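{- Let $\pi=\pi_1\cdots\pi_n\in\mathfrak{S}_n$ and partition its ascent set $\mathrm{Asc}(\pi)=\{i\in[n-1]:\pi_i<\pi_{i+1}\}$ into maximal blocks $b_1,\ldots,b_k$ of consecutive integers. Then the number of Boolean intervals $[\pi,w]$ in the right weak order $W(\mathfrak{S}_n)$ with $w\ne\pi$ is $$\left(\prod_{i=1}^k F_{|b_i|+2}\right)-1,$$ where $F_\ell$ is the $\ell$-th Fibonacci number with $F_1=F_2=1$.
   Context: $[n]=\{1,\ldots,n\}$; $s_i=(i,i+1)$. The right weak order $W(\mathfrak{S}_n)$ is the partial order on $\mathfrak{S}_n$ with cover relations $\tau\lessdot\tau s_i$ whenever $\tau(i)<\tau(i+1)$. An interval $[v,w]=\{u:v\le u\le w\}$ is a Boolean interval if it is isomorphic as a poset to the lattice of all subsets of a finite set ordered by inclusion. -}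

module Defs where

open import Data.Nat using (ℕ; zero; suc; _+_; _*_; _∸_; _<ᵇ_)
open import Data.Bool using (Bool; true; false)
open import Data.Fin using (Fin; toℕ)
open import Data.Fin.Subset using (Subset; _⊆_)
open import Data.Vec using (Vec; lookup; toList; _[_]≔_)
open import Data.List using (List; []; _∷_; _++_; map; length)
open import Data.List.Relation.Unary.Unique.Propositional using (Unique)
open import Data.List.Membership.Propositional using (_∈_)
open import Data.Product using (Σ; ∃; ∃-syntax; _×_; _,_)
open import Relation.Binary.PropositionalEquality using (_≡_; _≢_)
open import Relation.Binary.Construct.Closure.ReflexiveTransitive using (Star)
open import Function.Bundles using (_⇔_)
open import Level using (0ℓ)

-- A permutation π ∈ 𝔖ₙ in one-line notation π₁⋯πₙ, values in Fin n
-- (i.e. {0,…,n-1} standing for [n]).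
Word : ℕ → Set
Word n = Vec (Fin n) n

IsPerm : ∀ {n} → Word n → Set
IsPerm w = Unique (toList w)

-- Right multiplication by the adjacent transposition s_i:
-- swap the entries in positions i and j = i+1.
swapAt : ∀ {n} → Word n → Fin n → Fin n → Word n
swapAt w i j = (w [ i ]≔ lookup w j) [ j ]≔ lookup w i

data Cover {n : ℕ} (τ : Word n) : Word n → Set where
  cover : (i j : Fin n) → toℕ j ≡ suc (toℕ i) →
          toℕ (lookup τ i) Data.Nat.< toℕ (lookup τ j) →
          Cover τ (swapAt τ i j)

_≤W_ : ∀ {n} → Word n → Word n → Set
_≤W_ = Star Cover

InInterval : ∀ {n} → Word n → Word n → Word n → Set
InInterval v w u = (v ≤W u) × (u ≤W w)

-- [v, w] is a Boolean interval: it is isomorphic as a poset to the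
-- lattice of all subsets of a finite set {0,…,m-1}, ordered by inclusion.
-- f is the isomorphism (only its values on the interval matter), g its inverse.
IsBooleanInterval : ∀ {n} → Word n → Word n → Set
IsBooleanInterval {n} v w =
  ∃[ m ] Σ (Word n → Subset m) λ f → Σ (Subset m → Word n) λ g →
      ((s : Subset m) → InInterval v w (g s))
    × ((s : Subset m) → f (g s) ≡ s)
    × ((u : Word n) → InInterval v w u → g (f u) ≡ u)
    × ((u u′ : Word n) → InInterval v w u → InInterval v w u′ →
         (u ≤W u′) ⇔ (f u ⊆ f u′))

ascList : ∀ {n} → List (Fin n) → List Bool
ascList (x ∷ y ∷ xs) = (toℕ x <ᵇ toℕ y) ∷ ascList (y ∷ xs)
ascList _ = []

-- Sizes of the maximal runs of consecutive trues (the maximal blocks of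
-- consecutive integers of the ascent set).
private
  close : ℕ → List ℕ
  close zero = []
  close (suc k) = suc k ∷ []

  runsFrom : ℕ → List Bool → List ℕ
  runsFrom k [] = close k
  runsFrom k (true ∷ bs) = runsFrom (suc k) bs
  runsFrom k (false ∷ bs) = close k ++ runsFrom zero bs

blockSizes : List Bool → List ℕ
blockSizes = runsFrom zero

ascentBlockSizes : ∀ {n} → Word n → List ℕ
ascentBlockSizes π = blockSizes (ascList (toList π))

-- Fibonacci numbers, F₀ = 0, F₁ = F₂ = 1.
fib : ℕ → ℕ
fib zero = zero
fib (suc zero) = suc zero
fib (suc (suc k)) = fib (suc k) + fib k

-- "The number of elements w satisfying P is N": an explicit duplicate-free
-- list of exactly the words satisfying P, of length N.
HasCount : ∀ {n} → (Word n → Set) → ℕ → Set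
HasCount {n} P N = Σ (List (Word n)) λ ws →
  Unique ws × (length ws ≡ N) × ((w : Word n) → (w ∈ ws) ⇔ P w)

-- A tiling of π by monomers and dimers whose dimers sit on ascents gives the Boolean
-- interval [π, top t] of the words obtained by swapping any subset of the dimers; a word
-- of that interval is determined by which of the dimers it inverts. Conversely, if [π, w]
-- is Boolean, walk up a chain from π to w: when the current word is top t and the next
-- cover swaps c d, the lattice yields an atom π ⋖ b below the next word but not below top t,
-- and the inversion created by b can only be c d, so c d is an ascent adjacent in π and t
-- extends by one dimer. So the Boolean intervals above π are counted by the sets of pairwise
-- non-adjacent ascents, and a block of b consecutive ascents has F_{b+2} of them.

module Submission where

open import Defs
open import Data.Nat as ℕ using (ℕ; zero; suc; _+_; _*_; _∸_)
open import Data.Nat.Properties using (suc-injective; +-identityʳ; *-identityʳ; *-distribʳ-+; +-comm)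
open import Data.Nat.ListAction using (product)
open import Data.Bool using (Bool; true; false; if_then_else_)
open import Data.Fin using (Fin; toℕ; zero; suc; _<_)
open import Data.Fin.Properties using (<-irrefl; <-asym; <-irrelevant; _<?_)
open import Data.Fin.Subset using (Subset; _⊆_; _⊂_; ⊤; ⊥; ⁅_⁆; inside; outside)
  renaming (_∈_ to _∈ₛ_; _∉_ to _∉ₛ_)
open import Data.Fin.Subset.Properties
  using (⊆-refl; ⊆⊤; ⊥⊆; drop-∷-⊆; out⊆; s⊆s; out⊂; out⊂in; s⊂s; x∈⁅x⁆; x∈⁅y⁆⇒x≡y)
open import Data.Vec as Vec using (Vec; []; _∷_; lookup; _[_]≔_; toList)
open import Data.List using (List; []; _∷_; map; _++_; length; drop; replicate)
open import Data.List.Properties using (length-++; length-map; length-drop; ++-identityʳ)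
open import Data.List.Membership.Propositional using () renaming (_∈_ to _∈ₗ_)
open import Data.List.Membership.Propositional.Properties using (∈-map⁺; ∈-map⁻; ∈-++⁺ˡ; ∈-++⁺ʳ)
open import Data.List.Relation.Unary.Any using () renaming (here to hereₗ; there to thereₗ)
open import Data.List.Relation.Unary.Unique.Propositional using (Unique)
open import Data.List.Relation.Unary.Unique.Propositional.Properties using (map⁺; ++⁺; drop⁺)
open import Data.List.Relation.Unary.All.Properties using (All¬⇒¬Any; ¬Any⇒All¬)
open import Data.List.Relation.Unary.AllPairs using ([]; _∷_)
open import Data.List.Relation.Unary.All as All using ()
open import Data.Vec.Membership.Propositional using (_∈_; _∉_)
open import Data.Vec.Relation.Unary.Any using (here; there)
open import Data.Vec.Relation.Unary.Any.Properties using (toList⁺; toList⁻)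
open import Data.Vec.Properties using (∷-injectiveˡ; ∷-injectiveʳ)
open import Data.Product as Product using (∃; ∃₂; _×_; _,_; proj₁; proj₂; map₂)
open import Data.Sum as Sum using (_⊎_; inj₁; inj₂)
open import Function using (_∘_; id)
open import Function.Bundles using (_⇔_; mk⇔; Equivalence)
open import Function.Properties.Equivalence using () renaming (trans to ⇔-trans)
open import Relation.Nullary using (¬_; contradiction; does; Dec; yes; no)
open import Relation.Nullary.Decidable using (dec-true; dec-false)
open import Relation.Binary.PropositionalEquality
  using (_≡_; _≢_; refl; sym; trans; cong; cong₂; subst; subst₂; module ≡-Reasoning)
open import Relation.Binary.Construct.Closure.ReflexiveTransitive
  using (Star; ε; _◅_; _◅◅_; gmap)

private variable
  n k : ℕ
  a b c d x y z : Fin n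
  r u v w : Vec (Fin n) k

-- Right weak order and inversions

data Step (c d : Fin n) : Vec (Fin n) k → Vec (Fin n) k → Set where
  swap : c < d → Step c d (c ∷ d ∷ r) (d ∷ c ∷ r)
  skip : Step c d u v → Step c d (x ∷ u) (x ∷ v)

infix 4 _⋖_ _≼_ _⊆ᵢ_

_⋖_ : Vec (Fin n) k → Vec (Fin n) k → Set
u ⋖ v = ∃₂ λ c d → Step c d u v

_≼_ : Vec (Fin n) k → Vec (Fin n) k → Set
_≼_ = Star _⋖_

step-≼ : Step c d u v → u ≼ v
step-≼ s = (_ , _ , s) ◅ ε

≼-cons : u ≼ v → x ∷ u ≼ x ∷ v
≼-cons = gmap (_ ∷_) λ (c , d , s) → c , d , skip s

step-< : Step c d u v → c < d
step-< (swap c<d) = c<d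
step-< (skip s) = step-< s

step-≢ : Step c d u v → u ≢ v
step-≢ (swap c<d) refl = <-irrefl refl c<d
step-≢ (skip s) refl = step-≢ s refl

step-∈ : Step c d u v → c ∈ u × d ∈ u
step-∈ (swap _) = here refl , there (here refl)
step-∈ (skip s) = there (proj₁ (step-∈ s)) , there (proj₂ (step-∈ s))

∈-step : Step c d u v → z ∈ u → z ∈ v
∈-step (swap _) (here p) = there (here p)
∈-step (swap _) (there (here p)) = here p
∈-step (swap _) (there (there m)) = there (there m)
∈-step (skip s) (here p) = here p
∈-step (skip s) (there m) = there (∈-step s m)

∈-step⁻ : Step c d u v → z ∈ v → z ∈ u
∈-step⁻ (swap _) (here p) = there (here p)
∈-step⁻ (swap _) (there (here p)) = here p
∈-step⁻ (swap _) (there (there m)) = there (there m)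
∈-step⁻ (skip s) (here p) = here p
∈-step⁻ (skip s) (there m) = there (∈-step⁻ s m)

data Distinct : Vec (Fin n) k → Set where
  [] : Distinct {n} []
  _∷_ : x ∉ u → Distinct u → Distinct (x ∷ u)

Distinct-step : Step c d u v → Distinct u → Distinct v
Distinct-step (swap _) (c∉ ∷ d∉ ∷ du) =
  (λ { (here refl) → c∉ (here refl) ; (there m) → d∉ m }) ∷ (c∉ ∘ there) ∷ du
Distinct-step (skip s) (x∉ ∷ du) = (x∉ ∘ ∈-step⁻ s) ∷ Distinct-step s du

Distinct-≼ : u ≼ v → Distinct u → Distinct v
Distinct-≼ ε du = du
Distinct-≼ ((_ , _ , s) ◅ p) du = Distinct-≼ p (Distinct-step s du)

Unique⇒Distinct : (u : Vec (Fin n) k) → Unique (toList u) → Distinct u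
Unique⇒Distinct [] _ = []
Unique⇒Distinct (x ∷ u) (x∉ ∷ un) = All¬⇒¬Any x∉ ∘ toList⁺ ∷ Unique⇒Distinct u un

Distinct⇒Unique : (u : Vec (Fin n) k) → Distinct u → Unique (toList u)
Distinct⇒Unique [] [] = []
Distinct⇒Unique (x ∷ u) (x∉ ∷ du) = ¬Any⇒All¬ (toList u) (x∉ ∘ toList⁻) ∷ Distinct⇒Unique u du

data Precedes (a b : Fin n) : Vec (Fin n) k → Set where
  first : b ∈ u → Precedes a b (a ∷ u)
  later : Precedes a b u → Precedes a b (x ∷ u)

precedes-∈ : Precedes a b u → a ∈ u × b ∈ u
precedes-∈ (first m) = here refl , there m
precedes-∈ (later p) = there (proj₁ (precedes-∈ p)) , there (proj₂ (precedes-∈ p))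

step-inverts : Step c d u v → Precedes d c v
step-inverts (swap _) = first (here refl)
step-inverts (skip s) = later (step-inverts s)

step-preserves : Step c d u v → b < a → Precedes a b u → Precedes a b v
step-preserves (swap c<d) b<a (first (here refl)) = contradiction c<d (<-asym b<a)
step-preserves (swap _) _ (first (there m)) = later (first m)
step-preserves (swap _) _ (later (first m)) = first (there m)
step-preserves (swap _) _ (later (later p)) = later (later p)
step-preserves (skip s) _ (first m) = first (∈-step s m)
step-preserves (skip s) b<a (later p) = later (step-preserves s b<a p)

step-reflects : Step c d u v → Precedes a b v → Precedes a b u ⊎ (a ≡ d × b ≡ c)
step-reflects (swap _) (first (here refl)) = inj₂ (refl , refl)
step-reflects (swap _) (first (there m)) = inj₁ (later (first m))
step-reflects (swap _) (later (first m)) = inj₁ (first (there m))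
step-reflects (swap _) (later (later p)) = inj₁ (later (later p))
step-reflects (skip s) (first m) = inj₁ (first (∈-step⁻ s m))
step-reflects (skip s) (later p) = Sum.map₁ later (step-reflects s p)

_⊆ᵢ_ : Vec (Fin n) k → Vec (Fin n) k → Set
u ⊆ᵢ v = ∀ {a b} → b < a → Precedes a b u → Precedes a b v

≼⇒⊆ᵢ : u ≼ v → u ⊆ᵢ v
≼⇒⊆ᵢ ε b<a p = p
≼⇒⊆ᵢ ((_ , _ , s) ◅ q) b<a p = ≼⇒⊆ᵢ q b<a (step-preserves s b<a p)

precedes-tail : Precedes a b (x ∷ v) → x ∉ u → a ∈ u → Precedes a b v
precedes-tail (first _) x∉u a∈u = contradiction a∈u x∉u
precedes-tail (later p) _ _ = p

precedes-tail₂ : Precedes a b (x ∷ y ∷ v) → x ∉ u → y ∉ u → a ∈ u → Precedes a b v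
precedes-tail₂ p x∉u y∉u a∈u = precedes-tail (precedes-tail p x∉u a∈u) y∉u a∈u

data HeadSwap (d x : Fin n) : Vec (Fin n) k → Vec (Fin n) (suc k) → Set where
  headSwap : HeadSwap d x (d ∷ u) (d ∷ x ∷ u)

data ConsStep (c d x : Fin n) (u : Vec (Fin n) k) : Vec (Fin n) (suc k) → Set where
  atHead : c ≡ x → d ∈ u → HeadSwap d x u v → ConsStep c d x u v
  inTail : Step c d u v → ConsStep c d x u (x ∷ v)

consStep : Step c d (x ∷ u) v → ConsStep c d x u v
consStep (swap _) = atHead refl (here refl) headSwap
consStep (skip s) = inTail s

step-tail : Step c d (x ∷ v) w → x ∉ u → c ∈ u → ∃ λ w′ → w ≡ x ∷ w′ × Step c d v w′
step-tail st x∉u c∈u with consStep st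
... | atHead refl _ _ = contradiction c∈u x∉u
... | inTail st′ = _ , refl , st′

-- Monomer–dimer tilings

data Tiling : Vec (Fin n) k → Set where
  [] : Tiling {n} []
  mono : (x : Fin n) → Tiling u → Tiling (x ∷ u)
  dimer : (x y : Fin n) → x < y → Tiling u → Tiling (x ∷ y ∷ u)

dimers : Tiling u → ℕ
dimers [] = 0
dimers (mono _ t) = dimers t
dimers (dimer _ _ _ t) = suc (dimers t)

flipped : {u : Vec (Fin n) k} (t : Tiling u) → Subset (dimers t) → Vec (Fin n) k
flipped [] [] = []
flipped (mono x t) s = x ∷ flipped t s
flipped (dimer x y _ t) (outside ∷ s) = x ∷ y ∷ flipped t s
flipped (dimer x y _ t) (inside ∷ s) = y ∷ x ∷ flipped t s

top : {u : Vec (Fin n) k} → Tiling u → Vec (Fin n) k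
top t = flipped t ⊤

untiled : (u : Vec (Fin n) k) → Tiling u
untiled [] = []
untiled (x ∷ u) = mono x (untiled u)

top-untiled : (u : Vec (Fin n) k) → top (untiled u) ≡ u
top-untiled [] = refl
top-untiled (x ∷ u) = cong (x ∷_) (top-untiled u)

flipsOf : {u : Vec (Fin n) k} (t : Tiling u) → Vec (Fin n) k → Subset (dimers t)
flipsOf [] [] = []
flipsOf (mono _ t) (_ ∷ v) = flipsOf t v
flipsOf (dimer _ _ _ t) (v₀ ∷ v₁ ∷ v) = does (v₁ <? v₀) ∷ flipsOf t v

flipsOf-flipped : (t : Tiling u) (s : Subset (dimers t)) → flipsOf t (flipped t s) ≡ s
flipsOf-flipped [] [] = refl
flipsOf-flipped (mono _ t) s = flipsOf-flipped t s
flipsOf-flipped (dimer x y x<y t) (inside ∷ s) =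
  cong₂ Vec._∷_ (dec-true (x <? y) x<y) (flipsOf-flipped t s)
flipsOf-flipped (dimer x y x<y t) (outside ∷ s) =
  cong₂ Vec._∷_ (dec-false (y <? x) (<-asym x<y)) (flipsOf-flipped t s)

flipped-⊥ : (t : Tiling u) → flipped t ⊥ ≡ u
flipped-⊥ [] = refl
flipped-⊥ (mono x t) = cong (x ∷_) (flipped-⊥ t)
flipped-⊥ (dimer x y _ t) = cong (λ v → x ∷ y ∷ v) (flipped-⊥ t)

∈-flipped : (t : Tiling u) (s : Subset (dimers t)) → z ∈ flipped t s → z ∈ u
∈-flipped (mono x t) s (here p) = here p
∈-flipped (mono x t) s (there m) = there (∈-flipped t s m)
∈-flipped (dimer x y _ t) (outside ∷ s) (here p) = here p
∈-flipped (dimer x y _ t) (outside ∷ s) (there (here p)) = there (here p)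
∈-flipped (dimer x y _ t) (outside ∷ s) (there (there m)) = there (there (∈-flipped t s m))
∈-flipped (dimer x y _ t) (inside ∷ s) (here p) = there (here p)
∈-flipped (dimer x y _ t) (inside ∷ s) (there (here p)) = here p
∈-flipped (dimer x y _ t) (inside ∷ s) (there (there m)) = there (there (∈-flipped t s m))

∉-flipped : (t : Tiling u) (s : Subset (dimers t)) → z ∉ u → z ∉ flipped t s
∉-flipped t s z∉u = z∉u ∘ ∈-flipped t s

flipped-mono : (t : Tiling u) {s s′ : Subset (dimers t)} → s ⊆ s′ → flipped t s ≼ flipped t s′
flipped-mono [] {[]} {[]} _ = ε
flipped-mono (mono x t) s⊆s′ = ≼-cons (flipped-mono t s⊆s′)
flipped-mono (dimer x y x<y t) {outside ∷ s} {outside ∷ s′} s⊆s′ =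
  ≼-cons (≼-cons (flipped-mono t (drop-∷-⊆ s⊆s′)))
flipped-mono (dimer x y x<y t) {outside ∷ s} {inside ∷ s′} s⊆s′ =
  step-≼ (swap x<y) ◅◅ ≼-cons (≼-cons (flipped-mono t (drop-∷-⊆ s⊆s′)))
flipped-mono (dimer x y x<y t) {inside ∷ s} {inside ∷ s′} s⊆s′ =
  ≼-cons (≼-cons (flipped-mono t (drop-∷-⊆ s⊆s′)))
flipped-mono (dimer x y x<y t) {inside ∷ s} {outside ∷ s′} s⊆s′ with s⊆s′ Vec.here
... | ()

≼-flipped : (t : Tiling u) (s : Subset (dimers t)) → u ≼ flipped t s
≼-flipped t s = subst (_≼ flipped t s) (flipped-⊥ t) (flipped-mono t ⊥⊆)

flipped-reflects : (t : Tiling u) (s s′ : Subset (dimers t)) → Distinct u →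
                   flipped t s ⊆ᵢ flipped t s′ → s ⊆ s′
flipped-reflects [] [] [] _ _ = ⊆-refl
flipped-reflects (mono x t) s s′ (x∉ ∷ du) inc =
  flipped-reflects t s s′ du λ b<a p →
    precedes-tail (inc b<a (later p)) x∉ (∈-flipped t s (proj₁ (precedes-∈ p)))
flipped-reflects (dimer x y x<y t) (i ∷ s) (i′ ∷ s′) (x∉ ∷ y∉ ∷ du) inc =
  head i i′ (inc x<y) (flipped-reflects t s s′ du λ b<a p →
    drop-heads i′ (proj₁ (precedes-∈ p)) (inc b<a (add-heads i p)))
  where
    add-heads : ∀ i → Precedes a b (flipped t s) → Precedes a b (flipped (dimer x y x<y t) (i ∷ s))
    add-heads outside = later ∘ later
    add-heads inside = later ∘ later

    drop-heads : ∀ i′ → a ∈ flipped t s → Precedes a b (flipped (dimer x y x<y t) (i′ ∷ s′)) →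
                 Precedes a b (flipped t s′)
    drop-heads outside a∈ p = precedes-tail₂ p (x∉ ∘ there) y∉ (∈-flipped t s a∈)
    drop-heads inside a∈ p = precedes-tail₂ p y∉ (x∉ ∘ there) (∈-flipped t s a∈)

    head : ∀ i i′ → (Precedes y x (flipped (dimer x y x<y t) (i ∷ s)) →
                     Precedes y x (flipped (dimer x y x<y t) (i′ ∷ s′))) →
           s ⊆ s′ → i ∷ s ⊆ i′ ∷ s′
    head outside _ _ s⊆s′ = out⊆ s⊆s′
    head inside inside _ s⊆s′ = s⊆s s⊆s′
    head inside outside inc′ _ with inc′ (first (here refl))
    ... | first _ = contradiction x<y (<-irrefl refl)
    ... | later (first x∈) = contradiction (there (∈-flipped t s′ x∈)) x∉
    ... | later (later q) = contradiction (∈-flipped t s′ (proj₁ (precedes-∈ q))) y∉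

flipped-step : (t : Tiling u) (s : Subset (dimers t)) → Distinct u →
               Step c d (flipped t s) v → Precedes d c (top t) → ∃ λ s′ → v ≡ flipped t s′
flipped-step (mono x t) s (x∉ ∷ du) st dc with consStep st | dc
... | atHead refl _ _ | first _ = contradiction (step-< st) (<-irrefl refl)
... | atHead refl _ _ | later q = contradiction (proj₂ (precedes-∈ q)) (∉-flipped t ⊤ x∉)
... | inTail st′ | first _ = contradiction (proj₂ (step-∈ st′)) (∉-flipped t s x∉)
... | inTail st′ | later q = map₂ (cong (x ∷_)) (flipped-step t s du st′ q)
flipped-step (dimer x y x<y t) (outside ∷ s) (x∉ ∷ y∉ ∷ du) st dc with consStep st
... | atHead refl _ headSwap = inside ∷ s , refl
... | inTail st′ with consStep st′ | dc
...   | atHead refl _ _ | first _ = contradiction (step-< st′) (<-irrefl refl)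
...   | atHead refl d∈ _ | later (first _) = contradiction (there (∈-flipped t s d∈)) x∉
...   | atHead refl _ _ | later (later q) = contradiction (proj₂ (precedes-∈ q)) (∉-flipped t ⊤ y∉)
...   | inTail st″ | _ =
  Product.map (outside ∷_) (cong (λ w → x ∷ y ∷ w)) (flipped-step t s du st″
    (precedes-tail₂ dc y∉ (x∉ ∘ there) (∈-flipped t s (proj₂ (step-∈ st″)))))
flipped-step (dimer x y x<y t) (inside ∷ s) (x∉ ∷ y∉ ∷ du) st dc with consStep st
... | atHead refl _ headSwap = contradiction (step-< st) (<-asym x<y)
... | inTail st′ with consStep st′ | dc
...   | atHead refl d∈ _ | first _ = contradiction (∈-flipped t s d∈) y∉
...   | atHead refl _ _ | later (first _) = contradiction (step-< st′) (<-irrefl refl)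
...   | atHead refl _ _ | later (later q) =
  contradiction (there (∈-flipped t ⊤ (proj₂ (precedes-∈ q)))) x∉
...   | inTail st″ | _ =
  Product.map (inside ∷_) (cong (λ w → y ∷ x ∷ w)) (flipped-step t s du st″
    (precedes-tail₂ dc y∉ (x∉ ∘ there) (∈-flipped t s (proj₂ (step-∈ st″)))))

flipped-≼ : (t : Tiling u) (s : Subset (dimers t)) → Distinct u →
            flipped t s ≼ v → v ≼ top t → ∃ λ s′ → v ≡ flipped t s′
flipped-≼ t s du ε _ = s , refl
flipped-≼ t s du ((_ , _ , st) ◅ p) q
  with flipped-step t s du st (≼⇒⊆ᵢ (p ◅◅ q) (step-< st) (step-inverts st))
... | s′ , refl = flipped-≼ t s′ du p q

interval-flipped : (t : Tiling u) → Distinct u → u ≼ v → v ≼ top t → v ≡ flipped t (flipsOf t v)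
interval-flipped t du p q with flipped-≼ t ⊥ du (subst (_≼ _) (sym (flipped-⊥ t)) p) q
... | s , refl = cong (flipped t) (sym (flipsOf-flipped t s))

step-≼-top : (t : Tiling u) → Distinct u → Step c d u v → Precedes d c (top t) → v ≼ top t
step-≼-top (mono x t) (x∉ ∷ du) (swap x<d) (first _) = contradiction x<d (<-irrefl refl)
step-≼-top (mono x t) (x∉ ∷ du) (swap _) (later q) =
  contradiction (proj₂ (precedes-∈ q)) (∉-flipped t ⊤ x∉)
step-≼-top (mono x t) (x∉ ∷ du) (skip st) dc =
  ≼-cons (step-≼-top t du st (precedes-tail dc x∉ (proj₂ (step-∈ st))))
step-≼-top (dimer x y _ t) _ (swap _) _ = ≼-cons (≼-cons (≼-flipped t ⊤))
step-≼-top (dimer x y _ t) _ (skip (swap y<d)) (first _) = contradiction y<d (<-irrefl refl)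
step-≼-top (dimer x y _ t) (x∉ ∷ _) (skip (swap _)) (later (first _)) =
  contradiction (there (here refl)) x∉
step-≼-top (dimer x y _ t) (_ ∷ y∉ ∷ _) (skip (swap _)) (later (later q)) =
  contradiction (proj₂ (precedes-∈ q)) (∉-flipped t ⊤ y∉)
step-≼-top (dimer x y x<y t) (x∉ ∷ y∉ ∷ du) (skip (skip st)) dc =
  step-≼ (swap x<y) ◅◅ ≼-cons (≼-cons (step-≼-top t du st
    (precedes-tail₂ dc y∉ (x∉ ∘ there) (proj₂ (step-∈ st)))))

top-extend : (t : Tiling u) → Distinct u → Step c d u v → Step c d (top t) w →
           ∃ λ (t′ : Tiling u) → w ≡ top t′
top-extend (mono x t@(mono d t′)) (x∉ ∷ _) (swap x<d) st′ with consStep st′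
... | atHead refl _ headSwap = dimer x d x<d t′ , refl
... | inTail st″ = contradiction (proj₁ (step-∈ st″)) (∉-flipped t ⊤ x∉)
top-extend (mono x t@(dimer d e d<e _)) (x∉ ∷ _) (swap _) st′ with consStep st′
... | atHead refl _ headSwap = contradiction d<e (<-irrefl refl)
... | inTail st″ = contradiction (proj₁ (step-∈ st″)) (∉-flipped t ⊤ x∉)
top-extend (mono x t) (x∉ ∷ du) (skip st) st′ with step-tail st′ x∉ (proj₁ (step-∈ st))
... | _ , refl , st″ = Product.map (mono x) (cong (x ∷_)) (top-extend t du st st″)
top-extend (dimer x y x<y t) (x∉ ∷ y∉ ∷ _) (swap _) st′ with consStep st′
... | atHead refl _ _ = contradiction x<y (<-irrefl refl)
... | inTail st″ with consStep st″
...   | atHead _ y∈ _ = contradiction y∈ (∉-flipped t ⊤ y∉)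
...   | inTail st‴ = contradiction (proj₁ (step-∈ st‴)) (∉-flipped t ⊤ (x∉ ∘ there))
top-extend (dimer x y x<y t) (x∉ ∷ y∉ ∷ _) (skip (swap _)) st′ with consStep st′
... | atHead refl _ headSwap = contradiction (there (here refl)) x∉
... | inTail st″ with consStep st″
...   | atHead refl _ _ = contradiction x<y (<-irrefl refl)
...   | inTail st‴ = contradiction (proj₁ (step-∈ st‴)) (∉-flipped t ⊤ y∉)
top-extend (dimer x y x<y t) (x∉ ∷ y∉ ∷ du) (skip (skip st)) st′
  with step-tail st′ y∉ (proj₁ (step-∈ st))
... | _ , refl , st″ with step-tail st″ (x∉ ∘ there) (proj₁ (step-∈ st))
...   | _ , refl , st‴ =
  Product.map (dimer x y x<y) (cong (λ w → y ∷ x ∷ w)) (top-extend t du st st‴)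

-- The inversion created by u ⋖ w is in v but not in top t (by step-≼-top), so top t ⋖ v
-- swaps the same pair.
top-step-top : (t : Tiling u) → Distinct u → Step c d (top t) v →
               Step a b u w → w ≼ v → ¬ w ≼ top t → ∃ λ (t′ : Tiling u) → v ≡ top t′
top-step-top t du u→v u→w w≼v w⋠top
  with step-reflects u→v (≼⇒⊆ᵢ w≼v (step-< u→w) (step-inverts u→w))
... | inj₁ ba∈top = contradiction (step-≼-top t du u→w ba∈top) w⋠top
... | inj₂ (refl , refl) = top-extend t du u→w u→v

-- Boolean intervals

swapEntries : Vec (Fin n) k → Fin k → Fin k → Vec (Fin n) k
swapEntries τ i j = (τ [ i ]≔ lookup τ j) [ j ]≔ lookup τ i

data AscentSwap (τ : Vec (Fin n) k) : Vec (Fin n) k → Set where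
  ascentSwap : (i j : Fin k) → toℕ j ≡ suc (toℕ i) → lookup τ i < lookup τ j →
               AscentSwap τ (swapEntries τ i j)

ascentSwap⇒⋖ : AscentSwap u v → u ⋖ v
ascentSwap⇒⋖ {u = τ} (ascentSwap i j j≡1+i lt) = _ , _ , step τ i j j≡1+i lt
  where
    step : (τ : Vec (Fin n) k) (i j : Fin k) → toℕ j ≡ suc (toℕ i) → lookup τ i < lookup τ j →
           Step (lookup τ i) (lookup τ j) τ (swapEntries τ i j)
    step (_ ∷ _ ∷ _) zero (suc zero) refl lt = swap lt
    step (_ ∷ τ) (suc i) (suc j) j≡1+i lt = skip (step τ i j (suc-injective j≡1+i) lt)

step⇒ascentSwap : Step c d u v → AscentSwap u v
step⇒ascentSwap (swap c<d) = ascentSwap zero (suc zero) refl c<d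
step⇒ascentSwap (skip st) with step⇒ascentSwap st
... | ascentSwap i j j≡1+i lt = ascentSwap (suc i) (suc j) (cong suc j≡1+i) lt

≤W⇒≼ : {u v : Word n} → u ≤W v → u ≼ v
≤W⇒≼ = gmap id λ { (cover i j j≡1+i lt) → ascentSwap⇒⋖ (ascentSwap i j j≡1+i lt) }

≼⇒≤W : {u v : Word n} → u ≼ v → u ≤W v
≼⇒≤W = gmap id λ (_ , _ , st) → cover⇐ (step⇒ascentSwap st)
  where
    cover⇐ : {u v : Word n} → AscentSwap u v → Cover u v
    cover⇐ (ascentSwap i j j≡1+i lt) = cover i j j≡1+i lt

top-Boolean : {π : Word n} (t : Tiling π) → Distinct π → IsBooleanInterval π (top t)
top-Boolean {π = π} t dπ =
  dimers t , flipsOf t , flipped t , flipped-∈ , flipsOf-flipped t , flipped-flipsOf , order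
  where
    flipped-∈ : (s : Subset (dimers t)) → InInterval π (top t) (flipped t s)
    flipped-∈ s = ≼⇒≤W (≼-flipped t s) , ≼⇒≤W (flipped-mono t ⊆⊤)

    in-image : {u : Word _} → InInterval π (top t) u → u ≡ flipped t (flipsOf t u)
    in-image (p , q) = interval-flipped t dπ (≤W⇒≼ p) (≤W⇒≼ q)

    flipped-flipsOf : (u : Word _) → InInterval π (top t) u → flipped t (flipsOf t u) ≡ u
    flipped-flipsOf _ = sym ∘ in-image

    order : (u u′ : Word _) → InInterval π (top t) u → InInterval π (top t) u′ →
            (u ≤W u′) ⇔ (flipsOf t u ⊆ flipsOf t u′)
    order u u′ iu iu′ = mk⇔ to from
      where
        to : u ≤W u′ → flipsOf t u ⊆ flipsOf t u′
        to u≤u′ = flipped-reflects t _ _ dπ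
          (subst₂ _⊆ᵢ_ (in-image iu) (in-image iu′) (≼⇒⊆ᵢ (≤W⇒≼ u≤u′)))

        from : flipsOf t u ⊆ flipsOf t u′ → u ≤W u′
        from fu⊆fu′ = ≼⇒≤W
          (subst₂ _≼_ (sym (in-image iu)) (sym (in-image iu′)) (flipped-mono t fu⊆fu′))

⊆∧≢⇒⊂ : {p q : Subset k} → p ⊆ q → p ≢ q → p ⊂ q
⊆∧≢⇒⊂ {p = []} {[]} _ p≢q = contradiction refl p≢q
⊆∧≢⇒⊂ {p = outside ∷ p} {outside ∷ q} p⊆q p≢q =
  out⊂ (⊆∧≢⇒⊂ (drop-∷-⊆ p⊆q) (p≢q ∘ cong (outside ∷_)))
⊆∧≢⇒⊂ {p = outside ∷ p} {inside ∷ q} p⊆q _ = out⊂in (drop-∷-⊆ p⊆q)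
⊆∧≢⇒⊂ {p = inside ∷ p} {outside ∷ q} p⊆q _ with p⊆q Vec.here
... | ()
⊆∧≢⇒⊂ {p = inside ∷ p} {inside ∷ q} p⊆q p≢q =
  s⊂s (⊆∧≢⇒⊂ (drop-∷-⊆ p⊆q) (p≢q ∘ cong (inside ∷_)))

first-step : u ≼ v → u ≢ v → ∃ λ x → u ⋖ x × x ≼ v
first-step ε u≢u = contradiction refl u≢u
first-step (u⋖x ◅ x≼v) _ = _ , u⋖x , x≼v

module BooleanInterval
  {π w : Word n} {m : ℕ} {φ : Word n → Subset m} {ψ : Subset m → Word n}
  (ψ-∈ : ∀ s → InInterval π w (ψ s))
  (φ∘ψ : ∀ s → φ (ψ s) ≡ s)
  (ψ∘φ : ∀ u → InInterval π w u → ψ (φ u) ≡ u)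
  (order : ∀ u u′ → InInterval π w u → InInterval π w u′ → (u ≤W u′) ⇔ (φ u ⊆ φ u′))
  where

  private
    In : Word n → Set
    In u = π ≼ u × u ≼ w

    toInterval : {u : Word n} → In u → InInterval π w u
    toInterval (p , q) = ≼⇒≤W p , ≼⇒≤W q

    ψ-In : ∀ s → In (ψ s)
    ψ-In s = ≤W⇒≼ (proj₁ (ψ-∈ s)) , ≤W⇒≼ (proj₂ (ψ-∈ s))

    π-In : In π
    π-In = ε , ≤W⇒≼ (proj₁ (ψ-∈ ⊥)) ◅◅ ≤W⇒≼ (proj₂ (ψ-∈ ⊥))

    φ-mono : {u u′ : Word n} → In u → In u′ → u ≼ u′ → φ u ⊆ φ u′
    φ-mono iu iu′ = Equivalence.to (order _ _ (toInterval iu) (toInterval iu′)) ∘ ≼⇒≤W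

    φ-reflects : {u u′ : Word n} → In u → In u′ → φ u ⊆ φ u′ → u ≼ u′
    φ-reflects iu iu′ = ≤W⇒≼ ∘ Equivalence.from (order _ _ (toInterval iu) (toInterval iu′))

    φ-injective : {u u′ : Word n} → In u → In u′ → φ u ≡ φ u′ → u ≡ u′
    φ-injective {u} {u′} iu iu′ eq = begin
      u           ≡⟨ sym (ψ∘φ u (toInterval iu)) ⟩
      ψ (φ u)     ≡⟨ cong ψ eq ⟩
      ψ (φ u′)    ≡⟨ ψ∘φ u′ (toInterval iu′) ⟩
      u′          ∎
      where open ≡-Reasoning

    φ-strict : {u u′ : Word n} → In u → In u′ → u ≼ u′ → u ≢ u′ → φ u ⊂ φ u′
    φ-strict iu iu′ u≼u′ u≢u′ = ⊆∧≢⇒⊂ (φ-mono iu iu′ u≼u′) (u≢u′ ∘ φ-injective iu iu′)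

    atom : Fin m → Word n
    atom k = ψ ⁅ k ⁆

    ∈-φ-atom : {k k′ : Fin m} → k′ ∈ₛ φ (atom k) → k′ ≡ k
    ∈-φ-atom {k} k′∈ = x∈⁅y⁆⇒x≡y k (subst (_ ∈ₛ_) (φ∘ψ ⁅ k ⁆) k′∈)

    atom-≼ : {k : Fin m} {u : Word n} → In u → k ∈ₛ φ u → atom k ≼ u
    atom-≼ {k} iu k∈ = φ-reflects (ψ-In ⁅ k ⁆) iu λ k′∈ → subst (_∈ₛ φ _) (sym (∈-φ-atom k′∈)) k∈

    π≢atom : {k : Fin m} {u : Word n} → In u → k ∉ₛ φ u → π ≢ atom k
    π≢atom {k} iu k∉φu π≡a = k∉φu (φ-mono π-In iu (proj₁ iu) (subst (λ v → k ∈ₛ φ v) (sym π≡a) k∈φa))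
      where
        k∈φa : k ∈ₛ φ (atom k)
        k∈φa = subst (k ∈ₛ_) (sym (φ∘ψ ⁅ k ⁆)) (x∈⁅x⁆ k)

    below-atom-⋠ : {k : Fin m} {u b : Word n} → In u → k ∉ₛ φ u →
                   Step c d π b → b ≼ atom k → ¬ b ≼ u
    below-atom-⋠ {k = k} iu k∉φu π→b b≼a b≼u =
      let ib = step-≼ π→b , b≼a ◅◅ proj₂ (ψ-In ⁅ k ⁆)
          _ , k′ , k′∈φb , _ = φ-strict π-In ib (step-≼ π→b) (step-≢ π→b)
      in k∉φu (subst (_∈ₛ φ _) (∈-φ-atom (φ-mono ib (ψ-In ⁅ k ⁆) b≼a k′∈φb))
                                (φ-mono ib iu b≼u k′∈φb))

    -- For k ∈ φ x ∖ φ u, every cover of π below the atom ψ ⁅ k ⁆ is below x but not below u.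
    separating-atom : {u x : Word n} → In u → In x → u ≼ x → u ≢ x →
                      ∃₂ λ c d → ∃ λ b → Step c d π b × b ≼ x × ¬ b ≼ u
    separating-atom iu ix u≼x u≢x
      with _ , k , k∈φx , k∉φu ← φ-strict iu ix u≼x u≢x
      with b , (c , d , π→b) , b≼a ← first-step (proj₁ (ψ-In ⁅ k ⁆)) (π≢atom iu k∉φu)
      = c , d , b , π→b , b≼a ◅◅ atom-≼ ix k∈φx , below-atom-⋠ iu k∉φu π→b b≼a

  tiled : Distinct π → ∃ λ (t : Tiling π) → w ≡ top t
  tiled dπ = walk (untiled π) (sym (top-untiled π)) (proj₂ π-In)
    where
      walk : {u : Word n} (t : Tiling π) → u ≡ top t → u ≼ w → ∃ λ (t′ : Tiling π) → w ≡ top t′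
      walk t u≡top ε = t , u≡top
      walk t refl ((_ , _ , u→x) ◅ x≼w) =
        let _ , _ , _ , π→b , b≼x , b⋠u =
              separating-atom (≼-flipped t ⊤ , step-≼ u→x ◅◅ x≼w) (≼-flipped t ⊤ ◅◅ step-≼ u→x , x≼w)
                              (step-≼ u→x) (step-≢ u→x)
            t′ , x≡top = top-step-top t dπ u→x π→b b≼x b⋠u
        in walk t′ x≡top x≼w

Boolean⇔top : {π w : Word n} → Distinct π → IsBooleanInterval π w ⇔ ∃ λ (t : Tiling π) → w ≡ top t
Boolean⇔top dπ = mk⇔
  (λ (_ , _ , _ , ψ-∈ , φ∘ψ , ψ∘φ , order) → BooleanInterval.tiled ψ-∈ φ∘ψ ψ∘φ order dπ)
  (λ { (t , refl) → top-Boolean t dπ })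

-- Counting tilings

dimersIf : Dec (x < y) → List (Tiling u) → List (Tiling (x ∷ y ∷ u))
dimersIf (yes x<y) ts = map (dimer _ _ x<y) ts
dimersIf (no _) _ = []

tilings : (u : Vec (Fin n) k) → List (Tiling u)
tilings [] = [] ∷ []
tilings (x ∷ []) = mono x [] ∷ []
tilings (x ∷ y ∷ u) = map (mono x) (tilings (y ∷ u)) ++ dimersIf (x <? y) (tilings u)

∈-tilings : (t : Tiling u) → t ∈ₗ tilings u
∈-tilings [] = hereₗ refl
∈-tilings (mono x []) = hereₗ refl
∈-tilings (mono x t@(mono _ _)) = ∈-++⁺ˡ (∈-map⁺ (mono x) (∈-tilings t))
∈-tilings (mono x t@(dimer _ _ _ _)) = ∈-++⁺ˡ (∈-map⁺ (mono x) (∈-tilings t))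
∈-tilings (dimer x y x<y t) = ∈-++⁺ʳ _ (∈-dimersIf (x <? y) (∈-tilings t))
  where
    ∈-dimersIf : (x<?y : Dec (x < y)) {ts : List (Tiling _)} →
                 t ∈ₗ ts → dimer x y x<y t ∈ₗ dimersIf x<?y ts
    ∈-dimersIf (yes x<y′) t∈ rewrite <-irrelevant x<y x<y′ = ∈-map⁺ (dimer x y x<y′) t∈
    ∈-dimersIf (no x≮y) _ = contradiction x<y x≮y

tilings-unique : (u : Vec (Fin n) k) → Unique (tilings u)
tilings-unique [] = All.[] ∷ []
tilings-unique (x ∷ []) = All.[] ∷ []
tilings-unique (x ∷ y ∷ u) =
  ++⁺ (map⁺ (λ { refl → refl }) (tilings-unique (y ∷ u)))
      (dimersIf-unique (x <? y) (tilings-unique u)) (mono∉dimersIf (x <? y))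
  where
    dimersIf-unique : (x<?y : Dec (x < y)) {ts : List (Tiling u)} →
                      Unique ts → Unique (dimersIf x<?y ts)
    dimersIf-unique (yes _) = map⁺ λ { refl → refl }
    dimersIf-unique (no _) _ = []

    mono≢dimer : {t : Tiling (y ∷ u)} {t′ : Tiling u} {x<y : x < y} → mono x t ≢ dimer x y x<y t′
    mono≢dimer ()

    mono∉dimersIf : (x<?y : Dec (x < y)) {t : Tiling (x ∷ y ∷ u)} →
                    ¬ (t ∈ₗ map (mono x) (tilings (y ∷ u)) × t ∈ₗ dimersIf x<?y (tilings u))
    mono∉dimersIf (no _) (_ , ())
    mono∉dimersIf (yes _) (t∈mono , t∈dimer) =
      mono≢dimer (trans (sym (proj₂ (proj₂ (∈-map⁻ _ t∈mono)))) (proj₂ (proj₂ (∈-map⁻ _ t∈dimer))))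

-- The number of sets of pairwise non-adjacent positions of bs that hold true.
matchings : List Bool → ℕ
matchings [] = 1
matchings (false ∷ bs) = matchings bs
matchings (true ∷ []) = 2
matchings (true ∷ b ∷ bs) = matchings (b ∷ bs) + matchings bs

matchings-ascList : ∀ b (y : Fin n) l →
  matchings (b ∷ ascList (y ∷ l)) ≡
  matchings (ascList (y ∷ l)) + (if b then matchings (ascList l) else 0)
matchings-ascList false y l = sym (+-identityʳ _)
matchings-ascList true y [] = refl
matchings-ascList true y (z ∷ l) = refl

length-tilings : (u : Vec (Fin n) k) → length (tilings u) ≡ matchings (ascList (toList u))
length-tilings [] = refl
length-tilings (x ∷ []) = refl
length-tilings (x ∷ y ∷ u) = begin
  length (map (mono x) (tilings (y ∷ u)) ++ dimersIf (x <? y) (tilings u))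
    ≡⟨ length-++ (map (mono x) (tilings (y ∷ u))) ⟩
  length (map (mono x) (tilings (y ∷ u))) + length (dimersIf (x <? y) (tilings u))
    ≡⟨ cong₂ _+_ (trans (length-map _ (tilings (y ∷ u))) (length-tilings (y ∷ u)))
                 (length-dimersIf (x <? y) (length-tilings u)) ⟩
  matchings (ascList (toList (y ∷ u))) + (if does (x <? y) then matchings (ascList (toList u)) else 0)
    ≡⟨ sym (matchings-ascList (does (x <? y)) y (toList u)) ⟩
  matchings (ascList (toList (x ∷ y ∷ u))) ∎
  where
    open ≡-Reasoning
    length-dimersIf : (x<?y : Dec (x < y)) {ts : List (Tiling u)} {N : ℕ} → length ts ≡ N →
                      length (dimersIf x<?y ts) ≡ (if does x<?y then N else 0)
    length-dimersIf (yes _) {ts} eq = trans (length-map _ ts) eq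
    length-dimersIf (no _) _ = refl

mutual
  -- Defs keeps the accumulator-passing worker of blockSizes private;
  -- abstracting its initial accumulator 0 lets unification name it.
  runsFrom : ℕ → List Bool → List ℕ
  runsFrom = _

  blockSizes-runsFrom : ∀ bs → blockSizes bs ≡ runsFrom zero bs
  blockSizes-runsFrom bs with ℕ.zero
  ... | _ = refl

trues : ℕ → List Bool
trues k = replicate k true

trues-++-∷ : ∀ k bs → trues k ++ true ∷ bs ≡ true ∷ trues k ++ bs
trues-++-∷ zero bs = refl
trues-++-∷ (suc k) bs = cong (true ∷_) (trues-++-∷ k bs)

matchings-trues : ∀ k → matchings (trues k) ≡ fib (2 + k)
matchings-trues 0 = refl
matchings-trues 1 = refl
matchings-trues (suc (suc k)) = cong₂ _+_ (matchings-trues (suc k)) (matchings-trues k)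

matchings-trues-false : ∀ k bs → matchings (trues k ++ false ∷ bs) ≡ fib (2 + k) * matchings bs
matchings-trues-false 0 bs = sym (+-identityʳ _)
matchings-trues-false 1 bs = cong (matchings bs +_) (sym (+-identityʳ _))
matchings-trues-false (suc (suc k)) bs =
  trans (cong₂ _+_ (matchings-trues-false (suc k) bs) (matchings-trues-false k bs))
        (sym (*-distribʳ-+ (matchings bs) (fib (3 + k)) (fib (2 + k))))

fib-+2 : ∀ b → fib (b + 2) ≡ fib (2 + b)
fib-+2 b = cong fib (+-comm b 2)

product-runsFrom : ∀ k bs →
  product (map (λ b → fib (b + 2)) (runsFrom k bs)) ≡ matchings (trues k ++ bs)
product-runsFrom zero [] = refl
product-runsFrom (suc k) [] = begin
  fib (suc k + 2) * 1         ≡⟨ trans (*-identityʳ _) (fib-+2 (suc k)) ⟩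
  fib (2 + suc k)             ≡⟨ sym (matchings-trues (suc k)) ⟩
  matchings (trues (suc k))   ≡⟨ cong matchings (sym (++-identityʳ (trues (suc k)))) ⟩
  matchings (trues (suc k) ++ []) ∎
  where open ≡-Reasoning
product-runsFrom k (true ∷ bs) =
  trans (product-runsFrom (suc k) bs) (cong matchings (sym (trues-++-∷ k bs)))
product-runsFrom zero (false ∷ bs) = product-runsFrom zero bs
product-runsFrom (suc k) (false ∷ bs) = begin
  fib (suc k + 2) * product (map (λ b → fib (b + 2)) (runsFrom 0 bs))
    ≡⟨ cong₂ _*_ (fib-+2 (suc k)) (product-runsFrom 0 bs) ⟩
  fib (2 + suc k) * matchings bs
    ≡⟨ sym (matchings-trues-false (suc k) bs) ⟩
  matchings (trues (suc k) ++ false ∷ bs) ∎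
  where open ≡-Reasoning

product-blockSizes : ∀ bs → product (map (λ b → fib (b + 2)) (blockSizes bs)) ≡ matchings bs
product-blockSizes bs =
  trans (cong (product ∘ map (λ b → fib (b + 2))) (blockSizes-runsFrom bs)) (product-runsFrom 0 bs)

top-injective : Distinct u → (t t′ : Tiling u) → top t ≡ top t′ → t ≡ t′
top-injective _ [] [] _ = refl
top-injective (_ ∷ du) (mono x t) (mono x t′) eq =
  cong (mono x) (top-injective du t t′ (∷-injectiveʳ eq))
top-injective (x∉ ∷ _) (mono x _) (dimer x y _ _) eq = contradiction (here (∷-injectiveˡ eq)) x∉
top-injective (x∉ ∷ _) (dimer x y _ _) (mono x _) eq = contradiction (here (sym (∷-injectiveˡ eq))) x∉
top-injective (_ ∷ _ ∷ du) (dimer x y x<y t) (dimer x y x<y′ t′) eq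
  with refl ← top-injective du t t′ (∷-injectiveʳ (∷-injectiveʳ eq))
  = cong (λ x<y → dimer x y x<y t) (<-irrelevant x<y x<y′)

tilings-untiled : (u : Vec (Fin n) k) → tilings u ≡ untiled u ∷ drop 1 (tilings u)
tilings-untiled [] = refl
tilings-untiled (x ∷ []) = refl
tilings-untiled (x ∷ y ∷ u) rewrite tilings-untiled (y ∷ u) = refl

HasCount-⇔ : {P Q : Word n → Set} {N : ℕ} → (∀ w → P w ⇔ Q w) → HasCount P N → HasCount Q N
HasCount-⇔ P⇔Q (ws , unique , length≡ , ∈⇔P) = ws , unique , length≡ , λ w → ⇔-trans (∈⇔P w) (P⇔Q w)

HasCount-tops : {π : Word n} → Distinct π →
  HasCount (λ w → (∃ λ (t : Tiling π) → w ≡ top t) × w ≢ π) (length (tilings π) ∸ 1)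
HasCount-tops {π = π} dπ =
  map top nontrivial ,
  map⁺ (top-injective dπ _ _) (drop⁺ 1 (tilings-unique π)) ,
  trans (length-map top nontrivial) (length-drop 1 (tilings π)) ,
  λ w → mk⇔ to from
  where
    nontrivial : List (Tiling π)
    nontrivial = drop 1 (tilings π)

    untiled∉ : ¬ untiled π ∈ₗ nontrivial
    untiled∉ with untiled≢ ∷ _ ← subst Unique (tilings-untiled π) (tilings-unique π) =
      λ m → All.lookup untiled≢ m refl

    top≢π : {t : Tiling π} → t ∈ₗ nontrivial → top t ≢ π
    top≢π {t} t∈ top≡π =
      untiled∉ (subst (_∈ₗ nontrivial)
        (top-injective dπ t (untiled π) (trans top≡π (sym (top-untiled π)))) t∈)

    to : {w : Word _} → w ∈ₗ map top nontrivial → (∃ λ (t : Tiling π) → w ≡ top t) × w ≢ π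
    to w∈ with t , t∈ , refl ← ∈-map⁻ top w∈ = (t , refl) , top≢π t∈

    from : {w : Word _} → (∃ λ (t : Tiling π) → w ≡ top t) × w ≢ π → w ∈ₗ map top nontrivial
    from ((t , refl) , w≢π) with subst (t ∈ₗ_) (tilings-untiled π) (∈-tilings t)
    ... | hereₗ refl = contradiction (top-untiled π) w≢π
    ... | thereₗ t∈ = ∈-map⁺ top t∈

corollary5p6 : (n : ℕ) (π : Word n) → IsPerm π →
    HasCount (λ w → IsPerm w × w ≢ π × IsBooleanInterval π w)
             (product (map (λ b → fib (b + 2)) (ascentBlockSizes π)) ∸ 1)
corollary5p6 n π perm = subst (HasCount _) count (HasCount-⇔ characterisation (HasCount-tops dπ))
  where
    dπ : Distinct π
    dπ = Unique⇒Distinct π perm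

    characterisation : ∀ w → ((∃ λ (t : Tiling π) → w ≡ top t) × w ≢ π) ⇔
                             (IsPerm w × w ≢ π × IsBooleanInterval π w)
    characterisation w = mk⇔
      (λ { ((t , refl) , w≢π) → Distinct⇒Unique _ (Distinct-≼ (≼-flipped t ⊤) dπ) , w≢π ,
                                 Equivalence.from (Boolean⇔top dπ) (t , refl) })
      (λ (_ , w≢π , boolean) → Equivalence.to (Boolean⇔top dπ) boolean , w≢π)

    count : length (tilings π) ∸ 1 ≡ product (map (λ b → fib (b + 2)) (ascentBlockSizes π)) ∸ 1
    count = cong (_∸ 1) (trans (length-tilings π) (sym (product-blockSizes (ascList (toList π)))))
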